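{- Let $M$ be an $n\times n$ $(0,1)$-matrix, $d\ge1$ an integer and $\epsilon>0$. Let $W$ be a submatrix of $M$ with Boolean rank at most $d$. Then for every set $U$ of entries of $W$ there exists a skeleton $S=\{S_1,\ldots,S_d\}\in\mathcal{S}(M)$ such that $\bigcup_{i=1}^d S_i\subseteq U$ and no entry of $U$ is beneficial for $S$.
   Context: Entries of $M$ are pairs $(x,y)\in[n]\times[n]$; a $1$-entry is one with $M[x,y]=1$. The Boolean rank is the minimal number of all-ones combinatorial rectangles covering all $1$-entries. An entry $(x_1,y_1)$ is compatible with a $1$-entry $(x_2,y_2)$ if $M[x_1,y_2]=M[x_2,y_1]=1$; it is compatible with a set $S$ of $1$-entries if it is compatible with every entry of $S$, and incompatible otherwise. For a set $S$ of entries, $R(S)$ and $C(S)$ are its sets of rows and columns. For a row $x$, $Z(x)$ is the set of columns $y$ with $M[x,y]=0$; for a column $y$, $Z(y)$ is the set of rows $x$ with $M[x,y]=0$; for a set $X$ of rows, $Z(X)=\bigcup_{x\in X}Z(x)$, similarly for columns. With $g=\epsilon/(4d)$, row $x$ is zero-heavy with respect to $S$ if $|Z(x)\setminus Z(R(S))|\ge g n$, and column $y$ is zero-heavy w.r.t. $S$ if $|Z(y)\setminus Z(C(S))|\ge gn$; otherwise zero-light. An entry $(x,y)$ is influential w.r.t. a set $S$ of $1$-entries if $M[x,y]=1$, $(x,y)$ is compatible with $S$, and row $x$ or column $y$ is zero-heavy w.r.t. $S$. Skeletons are multisets of $d$ sets of $1$-entries defined inductively: $\{\emptyset,\ldots,\emptyset\}$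 ($d$ copies) is a skeleton; if $\{S_1,\ldots,S_d\}$ is a skeleton and $(x,y)$ is influential w.r.t. $S_i$ for some $i$, then the multiset obtained by replacing $S_i$ by $S_i\cup\{(x,y)\}$ is a skeleton. $\mathcal{S}(M)$ is the set of all skeletons. A $1$-entry $(x,y)$ is beneficial for a skeleton $\{S_1,\ldots,S_d\}$ if for every $i\in[d]$, $(x,y)$ is either incompatible with $S_i$ or influential w.r.t. $S_i$.
   Formalization: The parameter ε ranges over the positive rationals. -}

module Defs where

open import Data.Bool using (Bool; true; false; _∧_; _∨_; not)
open import Data.Nat using (ℕ; zero; suc; _+_; _*_; _≤_)
open import Data.Fin using (Fin; zero; suc; _≟_)
open import Data.Product using (Σ; _×_; _,_)
open import Data.Sum using (_⊎_)
open import Relation.Nullary using (¬_)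
open import Relation.Nullary.Decidable using (⌊_⌋)
open import Relation.Binary.PropositionalEquality using (_≡_)
open import Data.Vec.Functional using (Vector; replicate; updateAt)

-- An n×n (0,1)-matrix: M x y = true  iff  M[x,y] = 1.
Matrix : ℕ → Set
Matrix n = Fin n → Fin n → Bool

Lines : ℕ → Set
Lines n = Fin n → Bool

EntrySet : ℕ → Set
EntrySet n = Fin n → Fin n → Bool

∅ₑ : ∀ {n} → EntrySet n
∅ₑ _ _ = false

_∪｛_,_｝ : ∀ {n} → EntrySet n → Fin n → Fin n → EntrySet n
(S ∪｛ a , b ｝) x y = S x y ∨ (⌊ x ≟ a ⌋ ∧ ⌊ y ≟ b ⌋)

anyF : ∀ {n} → (Fin n → Bool) → Bool
anyF {zero}  f = false
anyF {suc n} f = f zero ∨ anyF (λ i → f (suc i))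

count : ∀ {n} → (Fin n → Bool) → ℕ
count {zero}  f = 0
count {suc n} f = (if f zero then 1 else 0) + count (λ i → f (suc i))
  where
  if_then_else_ : Bool → ℕ → ℕ → ℕ
  if true  then a else b = a
  if false then a else b = b

module _ {n : ℕ} (M : Matrix n) where

  RowsOf : EntrySet n → Lines n
  RowsOf S x = anyF (λ y → S x y)

  ColsOf : EntrySet n → Lines n
  ColsOf S y = anyF (λ x → S x y)

  inZRows : Lines n → Fin n → Bool
  inZRows X y = anyF (λ x → X x ∧ not (M x y))

  inZCols : Lines n → Fin n → Bool
  inZCols Y x = anyF (λ y → Y y ∧ not (M x y))

  rowExcess : EntrySet n → Fin n → ℕ
  rowExcess S x = count (λ y → not (M x y) ∧ not (inZRows (RowsOf S) y))

  colExcess : EntrySet n → Fin n → ℕ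
  colExcess S y = count (λ x → not (M x y) ∧ not (inZCols (ColsOf S) x))

  -- ε = p / q (p, q ≥ 1), g = ε/(4d).  "|A| ≥ g n"  ⇔  p * n ≤ 4 * d * q * |A|.
  module Params (d p q : ℕ) where

    ZeroHeavyRow : EntrySet n → Fin n → Set
    ZeroHeavyRow S x = p * n ≤ 4 * d * q * rowExcess S x

    ZeroHeavyCol : EntrySet n → Fin n → Set
    ZeroHeavyCol S y = p * n ≤ 4 * d * q * colExcess S y

    Compatible : Fin n → Fin n → Fin n → Fin n → Set
    Compatible x₁ y₁ x₂ y₂ = (M x₁ y₂ ≡ true) × (M x₂ y₁ ≡ true)

    CompatibleSet : Fin n → Fin n → EntrySet n → Set
    CompatibleSet x y S = ∀ x₂ y₂ → S x₂ y₂ ≡ true → Compatible x y x₂ y₂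

    Influential : Fin n → Fin n → EntrySet n → Set
    Influential x y S =
      (M x y ≡ true) × CompatibleSet x y S × (ZeroHeavyRow S x ⊎ ZeroHeavyCol S y)

    data Skeleton : Vector (EntrySet n) d → Set where
      base : Skeleton (replicate d ∅ₑ)
      step : ∀ {Ss} → Skeleton Ss → (i : Fin d) (x y : Fin n) →
             Influential x y (Ss i) →
             Skeleton (updateAt Ss i (λ S → S ∪｛ x , y ｝))

    Beneficial : Vector (EntrySet n) d → Fin n → Fin n → Set
    Beneficial Ss x y =
      (M x y ≡ true) × (∀ i → (¬ CompatibleSet x y (Ss i)) ⊎ Influential x y (Ss i))

  -- The submatrix W = M[X,Y] has Boolean rank at most d: its 1-entries are
  -- covered by d (possibly empty) all-ones combinatorial rectangles inside X × Y.
  BoolRankAtMost : Lines n → Lines n → ℕ → Set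
  BoolRankAtMost X Y d =
    Σ (Fin d → Lines n) λ Rs → Σ (Fin d → Lines n) λ Cs →
      (∀ i x → Rs i x ≡ true → X x ≡ true) ×
      (∀ i y → Cs i y ≡ true → Y y ≡ true) ×
      (∀ i x y → Rs i x ≡ true → Cs i y ≡ true → M x y ≡ true) ×
      (∀ x y → X x ≡ true → Y y ≡ true → M x y ≡ true →
         Σ (Fin d) λ i → (Rs i x ≡ true) × (Cs i y ≡ true))

-- Let R_i × C_i (i < d) be all-ones rectangles covering the 1-entries of W.  Grow a
-- skeleton greedily, keeping S_i inside U ∩ (R_i × C_i), by adding any entry of
-- U ∩ (R_i × C_i) that is zero-heavy w.r.t. S_i: entries of one all-ones rectangle are
-- pairwise compatible, so such an entry is influential w.r.t. S_i.  A member of S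
-- has no zeros outside Z(R(S)) (resp. Z(C(S))), so, as p ≥ 1, it is never
-- zero-heavy: every addition is a new entry and the process stops.  Then an entry
-- of U lying in R_i × C_i is compatible with S_i but not influential w.r.t. it,
-- hence not beneficial.
module Submission where

open import Defs
open import Data.Bool using (Bool; true; false; _∧_; not)
open import Data.Bool.Properties using (∨-zeroʳ) renaming (_≟_ to _≟ᵇ_)
open import Data.Nat using (ℕ; zero; suc; _+_; _*_; _≤_; _<_; _≤?_; z≤n; s≤s; >-nonZero⁻¹)
open import Data.Nat.Properties
  using (≤-refl; ≤-trans; ≤-reflexive; <-irrefl; +-mono-≤; +-mono-<-≤; +-mono-≤-<;
         +-monoˡ-≤; *-mono-≤; *-zeroʳ; +-identityʳ; +-suc; m≤n+m; n≮0)
open import Data.Fin using (Fin; zero; suc; _≟_)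
open import Data.Fin.Properties using (any?; nonZeroIndex)
open import Data.Product using (Σ; ∃-syntax; _×_; _,_; proj₁; proj₂)
open import Data.Sum using (_⊎_; inj₁; inj₂)
open import Data.Empty using (⊥-elim)
open import Relation.Nullary using (¬_; Dec; yes; no)
open import Relation.Nullary.Decidable using (_×-dec_; _⊎-dec_)
open import Relation.Binary.PropositionalEquality using (_≡_; refl; sym; cong; cong₂; subst₂)
open import Data.Vec.Functional using (Vector; replicate; updateAt)
open import Data.Vec.Functional.Properties using (updateAt-updates; updateAt-minimal)

∑ : ∀ {m} → (Fin m → ℕ) → ℕ
∑ {zero}  f = 0
∑ {suc m} f = f zero + ∑ (λ i → f (suc i))

∑-mono-≤ : ∀ {m} {f g : Fin m → ℕ} → (∀ i → f i ≤ g i) → ∑ f ≤ ∑ g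
∑-mono-≤ {zero}  f≤g = z≤n
∑-mono-≤ {suc m} f≤g = +-mono-≤ (f≤g zero) (∑-mono-≤ (λ i → f≤g (suc i)))

∑-mono-< : ∀ {m} {f g : Fin m → ℕ} → (∀ i → f i ≤ g i) → ∀ j → f j < g j → ∑ f < ∑ g
∑-mono-< f≤g zero    fj<gj = +-mono-<-≤ fj<gj (∑-mono-≤ (λ i → f≤g (suc i)))
∑-mono-< f≤g (suc j) fj<gj = +-mono-≤-< (f≤g zero) (∑-mono-< (λ i → f≤g (suc i)) j fj<gj)

∑≤* : ∀ {m} {f : Fin m → ℕ} {b} → (∀ i → f i ≤ b) → ∑ f ≤ m * b
∑≤* {zero}  f≤b = z≤n
∑≤* {suc m} f≤b = +-mono-≤ (f≤b zero) (∑≤* (λ i → f≤b (suc i)))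

fromBool : Bool → ℕ
fromBool true  = 1
fromBool false = 0

fromBool≤1 : ∀ b → fromBool b ≤ 1
fromBool≤1 true  = s≤s z≤n
fromBool≤1 false = z≤n

fromBool-mono : ∀ {a b} → (a ≡ true → b ≡ true) → fromBool a ≤ fromBool b
fromBool-mono {true}  a⇒b rewrite a⇒b refl = ≤-refl
fromBool-mono {false} a⇒b = z≤n

anyF-intro : ∀ {m} (f : Fin m → Bool) i → f i ≡ true → anyF f ≡ true
anyF-intro f zero    fi rewrite fi = refl
anyF-intro f (suc i) fi with f zero
... | true  = refl
... | false = anyF-intro (λ j → f (suc j)) i fi

count-false : ∀ {m} (f : Fin m → Bool) → (∀ i → f i ≡ false) → count f ≡ 0
count-false {zero}  f f≡false = refl
count-false {suc m} f f≡false rewrite f≡false zero =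
  count-false (λ i → f (suc i)) (λ i → f≡false (suc i))

module _ {n : ℕ} where

  infix 4 _⊆ₑ_

  _⊆ₑ_ : EntrySet n → EntrySet n → Set
  S ⊆ₑ T = ∀ x y → S x y ≡ true → T x y ≡ true

  ∪｛｝-⊇ : ∀ S (a b : Fin n) → S ⊆ₑ S ∪｛ a , b ｝
  ∪｛｝-⊇ S a b x y Sxy rewrite Sxy = refl

  ∪｛｝-new : ∀ S (a b : Fin n) → (S ∪｛ a , b ｝) a b ≡ true
  ∪｛｝-new S a b with a ≟ a | b ≟ b
  ... | yes _ | yes _   = ∨-zeroʳ (S a b)
  ... | no a≢a | _      = ⊥-elim (a≢a refl)
  ... | yes _ | no b≢b  = ⊥-elim (b≢b refl)

  ∪｛｝-cases : ∀ S (a b x y : Fin n) → (S ∪｛ a , b ｝) x y ≡ true →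
               S x y ≡ true ⊎ (x ≡ a × y ≡ b)
  ∪｛｝-cases S a b x y e with S x y | x ≟ a | y ≟ b
  ... | true  | _        | _        = inj₁ refl
  ... | false | yes x≡a  | yes y≡b  = inj₂ (x≡a , y≡b)
  ... | false | yes _    | no _     with () ← e
  ... | false | no _     | _        with () ← e

  size : EntrySet n → ℕ
  size S = ∑ λ x → ∑ λ y → fromBool (S x y)

  size≤ : ∀ S → size S ≤ n * (n * 1)
  size≤ S = ∑≤* λ x → ∑≤* λ y → fromBool≤1 (S x y)

  size-mono-≤ : ∀ {S T} → S ⊆ₑ T → size S ≤ size T
  size-mono-≤ S⊆T = ∑-mono-≤ λ x → ∑-mono-≤ λ y → fromBool-mono (S⊆T x y)

  size-mono-< : ∀ {S T} → S ⊆ₑ T → ∀ x y → S x y ≡ false → T x y ≡ true → size S < size T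
  size-mono-< S⊆T x y Sxy Txy =
    ∑-mono-< (λ x → ∑-mono-≤ λ y → fromBool-mono (S⊆T x y)) x
      (∑-mono-< (λ y → fromBool-mono (S⊆T x y)) y
        (subst₂ (λ s t → fromBool s < fromBool t) (sym Sxy) (sym Txy) (s≤s z≤n)))

module _ {n d : ℕ} where

  insert : Vector (EntrySet n) d → Fin d → Fin n → Fin n → Vector (EntrySet n) d
  insert Ss i x y = updateAt Ss i (λ S → S ∪｛ x , y ｝)

  insert-⊇ : ∀ Ss i x y j → Ss j ⊆ₑ insert Ss i x y j
  insert-⊇ Ss i x y j with j ≟ i
  ... | yes refl rewrite updateAt-updates j {λ S → S ∪｛ x , y ｝} Ss = ∪｛｝-⊇ (Ss j) x y
  ... | no j≢i   rewrite updateAt-minimal j i {λ S → S ∪｛ x , y ｝} Ss j≢i = λ _ _ e → e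

  insert-new : ∀ Ss i x y → insert Ss i x y i x y ≡ true
  insert-new Ss i x y rewrite updateAt-updates i {λ S → S ∪｛ x , y ｝} Ss = ∪｛｝-new (Ss i) x y

  insert-cases : ∀ Ss i x y j a b → insert Ss i x y j a b ≡ true →
                 Ss j a b ≡ true ⊎ (j ≡ i × a ≡ x × b ≡ y)
  insert-cases Ss i x y j a b e with j ≟ i
  ... | no j≢i   rewrite updateAt-minimal j i {λ S → S ∪｛ x , y ｝} Ss j≢i = inj₁ e
  ... | yes refl rewrite updateAt-updates j {λ S → S ∪｛ x , y ｝} Ss
    with ∪｛｝-cases (Ss j) x y a b e
  ...   | inj₁ old             = inj₁ old
  ...   | inj₂ (a≡x , b≡y)     = inj₂ (refl , a≡x , b≡y)

  totalSize : Vector (EntrySet n) d → ℕ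
  totalSize Ss = ∑ λ i → size (Ss i)

  totalSize≤ : ∀ Ss → totalSize Ss ≤ d * (n * (n * 1))
  totalSize≤ Ss = ∑≤* λ i → size≤ (Ss i)

  totalSize-insert : ∀ Ss i x y → Ss i x y ≡ false → totalSize Ss < totalSize (insert Ss i x y)
  totalSize-insert Ss i x y fresh =
    ∑-mono-< (λ j → size-mono-≤ (insert-⊇ Ss i x y j)) i
      (size-mono-< (insert-⊇ Ss i x y i) x y fresh (insert-new Ss i x y))

bounded-ascent : {A : Set} (P Q : A → Set) (μ : A → ℕ) (B : ℕ) → (∀ a → μ a ≤ B) →
                 (∀ a → P a → Q a ⊎ ∃[ a′ ] P a′ × μ a < μ a′) →
                 ∀ a → P a → ∃[ a ] P a × Q a
bounded-ascent P Q μ B μ≤B step a₀ Pa₀ = go B a₀ Pa₀ (m≤n+m B (μ a₀))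
  where
  go : ∀ k a → P a → B ≤ μ a + k → ∃[ a ] P a × Q a
  go k a Pa B≤μa+k with step a Pa
  go k       a Pa B≤μa+k | inj₁ Qa = a , Pa , Qa
  go zero    a Pa B≤μa+0 | inj₂ (a′ , Pa′ , μa<μa′) =
    ⊥-elim (<-irrefl refl (≤-trans μa<μa′ (≤-trans (μ≤B a′)
                             (≤-trans B≤μa+0 (≤-reflexive (+-identityʳ (μ a)))))))
  go (suc k) a Pa B≤μa+k | inj₂ (a′ , Pa′ , μa<μa′) =
    go k a′ Pa′ (≤-trans B≤μa+k (≤-trans (≤-reflexive (+-suc (μ a) k)) (+-monoˡ-≤ k μa<μa′)))

module _ {n : ℕ} (M : Matrix n) where

  rowExcess-member : ∀ S x y → S x y ≡ true → rowExcess M S x ≡ 0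
  rowExcess-member S x y Sxy = count-false _ covered
    where
    covered : ∀ y′ → (not (M x y′) ∧ not (inZRows M (RowsOf M S) y′)) ≡ false
    covered y′ with M x y′ in Mxy′
    ... | true  = refl
    ... | false rewrite anyF-intro (λ x′ → RowsOf M S x′ ∧ not (M x′ y′)) x
                          (cong₂ _∧_ (anyF-intro (S x) y Sxy) (cong not Mxy′)) = refl

  colExcess-member : ∀ S x y → S x y ≡ true → colExcess M S y ≡ 0
  colExcess-member S x y Sxy = count-false _ covered
    where
    covered : ∀ x′ → (not (M x′ y) ∧ not (inZCols M (ColsOf M S) x′)) ≡ false
    covered x′ with M x′ y in Mx′y
    ... | true  = refl
    ... | false rewrite anyF-intro (λ y′ → ColsOf M S y′ ∧ not (M x′ y′)) y
                          (cong₂ _∧_ (anyF-intro (λ x″ → S x″ y) x Sxy) (cong not Mx′y)) = refl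

  module _ {d p q : ℕ} (1≤p : 1 ≤ p) where
    open Params M d p q

    noExcess⇒¬heavy : ∀ {e} → Fin n → e ≡ 0 → ¬ p * n ≤ 4 * d * q * e
    noExcess⇒¬heavy x refl pn≤0 =
      n≮0 (≤-trans (*-mono-≤ 1≤p (>-nonZero⁻¹ n {{nonZeroIndex x}}))
                   (≤-trans pn≤0 (≤-reflexive (*-zeroʳ (4 * d * q)))))

    member⇒zeroLight : ∀ S x y → S x y ≡ true → ¬ (ZeroHeavyRow S x ⊎ ZeroHeavyCol S y)
    member⇒zeroLight S x y Sxy (inj₁ heavy) = noExcess⇒¬heavy x (rowExcess-member S x y Sxy) heavy
    member⇒zeroLight S x y Sxy (inj₂ heavy) = noExcess⇒¬heavy x (colExcess-member S x y Sxy) heavy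

module Greedy {n : ℕ} (M : Matrix n) (d p q : ℕ) (1≤p : 1 ≤ p)
  (Rs Cs : Fin d → Lines n)
  (rect : ∀ i x y → Rs i x ≡ true → Cs i y ≡ true → M x y ≡ true)
  (U : EntrySet n)
  (U-covered : ∀ x y → U x y ≡ true → M x y ≡ true → ∃[ i ] Rs i x ≡ true × Cs i y ≡ true)
  where

  open Params M d p q

  Confined : Vector (EntrySet n) d → Set
  Confined Ss = ∀ i x y → Ss i x y ≡ true → U x y ≡ true × Rs i x ≡ true × Cs i y ≡ true

  confined-compatible : ∀ {Ss i x y} → Confined Ss → Rs i x ≡ true → Cs i y ≡ true →
                        CompatibleSet x y (Ss i)
  confined-compatible {i = i} {x} {y} confined Rix Ciy x₂ y₂ e =
    let (_ , Rix₂ , Ciy₂) = confined i x₂ y₂ e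
    in rect i x y₂ Rix Ciy₂ , rect i x₂ y Rix₂ Ciy

  Growable : Vector (EntrySet n) d → Fin d → Fin n → Fin n → Set
  Growable Ss i x y =
    U x y ≡ true × Rs i x ≡ true × Cs i y ≡ true × (ZeroHeavyRow (Ss i) x ⊎ ZeroHeavyCol (Ss i) y)

  growable? : ∀ Ss i x y → Dec (Growable Ss i x y)
  growable? Ss i x y =
    (U x y ≟ᵇ true) ×-dec (Rs i x ≟ᵇ true) ×-dec (Cs i y ≟ᵇ true) ×-dec
    ((p * n ≤? _) ⊎-dec (p * n ≤? _))

  Saturated : Vector (EntrySet n) d → Set
  Saturated Ss = ∀ x y → U x y ≡ true → ¬ Beneficial Ss x y

  Invariant : Vector (EntrySet n) d → Set
  Invariant Ss = Skeleton Ss × Confined Ss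

  grow : ∀ {Ss i x y} → Invariant Ss → Growable Ss i x y →
         Invariant (insert Ss i x y) × totalSize Ss < totalSize (insert Ss i x y)
  grow {Ss} {i} {x} {y} (skeleton , confined) (Uxy , Rix , Ciy , heavy) =
    (step skeleton i x y (rect i x y Rix Ciy , confined-compatible confined Rix Ciy , heavy) ,
     confined′) ,
    totalSize-insert Ss i x y fresh
    where
    fresh : Ss i x y ≡ false
    fresh with Ss i x y in Sixy
    ... | true  = ⊥-elim (member⇒zeroLight M {d} {p} {q} 1≤p (Ss i) x y Sixy heavy)
    ... | false = refl
    confined′ : Confined (insert Ss i x y)
    confined′ j a b e with insert-cases Ss i x y j a b e
    ... | inj₁ old                  = confined j a b old
    ... | inj₂ (refl , refl , refl) = Uxy , Rix , Ciy

  ungrowable⇒saturated : ∀ {Ss} → Confined Ss → ¬ (∃[ i ] ∃[ x ] ∃[ y ] Growable Ss i x y) →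
                         Saturated Ss
  ungrowable⇒saturated confined ungrowable x y Uxy (Mxy , incompatible-or-influential)
    with U-covered x y Uxy Mxy
  ... | i , Rix , Ciy with incompatible-or-influential i
  ...   | inj₁ incompatible         = incompatible (confined-compatible confined Rix Ciy)
  ...   | inj₂ (_ , _ , heavy)      = ungrowable (i , x , y , Uxy , Rix , Ciy , heavy)

  saturate-or-grow : ∀ Ss → Invariant Ss →
                     Saturated Ss ⊎ ∃[ Ts ] Invariant Ts × totalSize Ss < totalSize Ts
  saturate-or-grow Ss inv@(_ , confined)
    with any? (λ i → any? (λ x → any? (λ y → growable? Ss i x y)))
  ... | yes (i , x , y , growable) = inj₂ (insert Ss i x y , grow inv growable)
  ... | no ungrowable              = inj₁ (ungrowable⇒saturated confined ungrowable)

  saturatedSkeleton : ∃[ Ss ] Invariant Ss × Saturated Ss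
  saturatedSkeleton =
    bounded-ascent Invariant Saturated totalSize _ totalSize≤ saturate-or-grow
      (replicate d ∅ₑ) (base , λ _ _ _ ())

lemma1 : (n : ℕ) (M : Matrix n) (d p q : ℕ) → 1 ≤ d → 1 ≤ p → 1 ≤ q →
         (X Y : Lines n) → BoolRankAtMost M X Y d →
         (U : EntrySet n) →
         (∀ x y → U x y ≡ true → (X x ≡ true) × (Y y ≡ true)) →
         Σ (Vector (EntrySet n) d) λ Ss →
           Params.Skeleton M d p q Ss ×
           (∀ i x y → Ss i x y ≡ true → U x y ≡ true) ×
           (∀ x y → U x y ≡ true → ¬ Params.Beneficial M d p q Ss x y)
lemma1 n M d p q _ 1≤p _ X Y (Rs , Cs , _ , _ , rect , cover) U U⊆W =
  let (Ss , (skeleton , confined) , saturated) =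
        Greedy.saturatedSkeleton M d p q 1≤p Rs Cs rect U U-covered
  in Ss , skeleton , (λ i x y e → proj₁ (confined i x y e)) , saturated
  where
  U-covered : ∀ x y → U x y ≡ true → M x y ≡ true → ∃[ i ] Rs i x ≡ true × Cs i y ≡ true
  U-covered x y Uxy = cover x y (proj₁ (U⊆W x y Uxy)) (proj₂ (U⊆W x y Uxy))
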